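{- (Relative completeness of PRHL.) Suppose the language of assertions is WPR-expressive. Then every valid partial reverse Hoare triple $\{P\}\,C\,\{Q\}$ is provable in PRHL.
   Context: Programs, assertions and semantics: states $\sigma:\mathrm{Var}\to\mathbb{N}$; expressions $E ::= x\mid n\mid f(E,\dots,E)$; Boolean conditions $B ::= Q(E,\dots,E)\mid E=E\mid E\le E\mid\neg B\mid B\wedge B\mid B\vee B$; programs $C ::= \varepsilon\mid C'$, $C' ::= x:=E\mid C';C'\mid\mathtt{while}\ B\ \mathtt{do}\ C\mid C\ \mathtt{or}\ C$ ($\varepsilon$ the empty program; $C_0;C_1$ denotes $C_i$ when $C_{1-i}=\varepsilon$); assertions are first-order formulas over Boolean conditions with $\neg,\vee,\wedge,\to,\exists,\forall$, interpreted over $\mathbb{N}$ ($\sigma\models P$); $P\models Q$ means every state satisfying $P$ satisfies $Q$; $Q[x:=E]$ is substitution. Small-step semantics: $\langle x:=E,\sigma\rangle\to\langle\varepsilon,\sigma[x\mapsto[\![E]\!]\sigma]\rangle$; $\langle\mathtt{while}\ B\ \mathtt{do}\ C,\sigma\rangle\to\langle C;\mathtt{while}\ B\ \mathtt{do}\ C,\sigma\rangle$ if $B$ holds in $\sigma$, else $\to\langle\varepsilon,\sigma\rangle$; $\langle C_0;C_1,\sigma\rangle\to\langle C_0';C_1,\sigma'\rangle$ if $\langle C_0,\sigma\rangle\to\langle C_0',\sigma'\rangle$; $\langle C_0\ \mathtt{or}\ C_1,\sigma\rangle\to\langle C_i,\sigma\rangle$ ($i=0,1$); $\to^{*}$ the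 reflexive-transitive closure. A triple $\{P\}\,C\,\{Q\}$ is valid if for all $\sigma'\models Q$ and all $\sigma$ with $\langle C,\sigma\rangle\to^{*}\langle\varepsilon,\sigma'\rangle$, $\sigma\models P$. The language of assertions is WPR-expressive if for every assertion $Q$ and program $C$ there is an assertion $P$ such that for every state $\sigma$: $\sigma\models P$ iff there exists $\sigma'$ with $\langle C,\sigma\rangle\to^{*}\langle\varepsilon,\sigma'\rangle$ and $\sigma'\models Q$. PRHL is the proof system whose proofs are finite derivation trees built from the rules: (Axiom) $\{Q\}\,\varepsilon\,\{Q\}$; (Assign) $\{Q[x:=E]\}\,x:=E\,\{Q\}$; (Seq) from $\{P\}C_0\{R\}$ and $\{R\}C_1\{Q\}$ infer $\{P\}C_0;C_1\{Q\}$; (Cons) from $\{P\}C\{Q\}$ infer $\{P'\}C\{Q'\}$ provided $P\models P'$ and $Q'\models Q$; (Or) from $\{P\}C_0\{Q\}$ and $\{P\}C_1\{Q\}$ infer $\{P\}C_0\ \mathtt{or}\ C_1\{Q\}$; (While) from $\{B\to P\}C\{P\}$ infer $\{P\}\,\mathtt{while}\ B\ \mathtt{do}\ C\,\{\neg B\to P\}$. Every leaf must be an instance of Axiom or Assign. -}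

module Defs where

open import Data.Nat using (ℕ; suc; _≟_; _≤_; _⊔_)
open import Data.Bool using (if_then_else_)
open import Data.Vec using (Vec; []; _∷_)
open import Data.Product using (Σ; _×_; _,_)
open import Data.Sum using (_⊎_)
open import Relation.Nullary using (¬_; does)
open import Relation.Binary.PropositionalEquality using (_≡_)
open import Relation.Binary.Construct.Closure.ReflexiveTransitive using (Star)

Var : Set
Var = ℕ

State : Set
State = Var → ℕ

_[_↦_] : {A : Set} → (Var → A) → Var → A → (Var → A)
(σ [ x ↦ n ]) y = if does (x ≟ y) then n else σ y

record Signature : Set₁ where
  field
    FunSym     : Set
    funArity   : FunSym → ℕ
    funInterp  : (f : FunSym) → Vec ℕ (funArity f) → ℕ
    PredSym    : Set
    predArity  : PredSym → ℕ
    predInterp : (q : PredSym) → Vec ℕ (predArity q) → Set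

module _ (S : Signature) where
  open Signature S

  data Expr : Set where
    var   : Var → Expr
    const : ℕ → Expr
    app   : (f : FunSym) → Vec Expr (funArity f) → Expr

  data Cond : Set where
    pred : (q : PredSym) → Vec Expr (predArity q) → Cond
    _==_ : Expr → Expr → Cond
    _≤ᶜ_ : Expr → Expr → Cond
    notᶜ : Cond → Cond
    _andᶜ_ : Cond → Cond → Cond
    _orᶜ_  : Cond → Cond → Cond

  data Assn : Set where
    cond  : Cond → Assn
    ¬ₐ_   : Assn → Assn
    _∨ₐ_  : Assn → Assn → Assn
    _∧ₐ_  : Assn → Assn → Assn
    _⇒ₐ_  : Assn → Assn → Assn
    ∃ₐ    : Var → Assn → Assn
    ∀ₐ    : Var → Assn → Assn

  mutual
    data Prog : Set where
      ε  : Prog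
      ne : Prog' → Prog

    data Prog' : Set where
      _:=_    : Var → Expr → Prog'
      _︔_    : Prog' → Prog' → Prog'
      while_loop_ : Cond → Prog → Prog'
      _or_    : Prog → Prog → Prog'

  -- C₀;C₁ on arbitrary programs, denoting Cᵢ when C₁₋ᵢ = ε
  _⨾_ : Prog → Prog → Prog
  ε ⨾ C₁ = C₁
  ne a ⨾ ε = ne a
  ne a ⨾ ne b = ne (a ︔ b)

  mutual
    ⟦_⟧ : Expr → State → ℕ
    ⟦ var x ⟧ σ = σ x
    ⟦ const n ⟧ σ = n
    ⟦ app f es ⟧ σ = funInterp f (⟦ es ⟧* σ)

    ⟦_⟧* : ∀ {k} → Vec Expr k → State → Vec ℕ k
    ⟦ [] ⟧* σ = []
    ⟦ e ∷ es ⟧* σ = ⟦ e ⟧ σ ∷ ⟦ es ⟧* σ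

  _⊨ᶜ_ : State → Cond → Set
  σ ⊨ᶜ pred q es = predInterp q (⟦ es ⟧* σ)
  σ ⊨ᶜ (e₁ == e₂) = ⟦ e₁ ⟧ σ ≡ ⟦ e₂ ⟧ σ
  σ ⊨ᶜ (e₁ ≤ᶜ e₂) = ⟦ e₁ ⟧ σ ≤ ⟦ e₂ ⟧ σ
  σ ⊨ᶜ notᶜ B = ¬ (σ ⊨ᶜ B)
  σ ⊨ᶜ (B₁ andᶜ B₂) = (σ ⊨ᶜ B₁) × (σ ⊨ᶜ B₂)
  σ ⊨ᶜ (B₁ orᶜ B₂) = (σ ⊨ᶜ B₁) ⊎ (σ ⊨ᶜ B₂)

  _⊨_ : State → Assn → Set
  σ ⊨ cond B = σ ⊨ᶜ B
  σ ⊨ (¬ₐ P) = ¬ (σ ⊨ P)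
  σ ⊨ (P ∨ₐ Q) = (σ ⊨ P) ⊎ (σ ⊨ Q)
  σ ⊨ (P ∧ₐ Q) = (σ ⊨ P) × (σ ⊨ Q)
  σ ⊨ (P ⇒ₐ Q) = σ ⊨ P → σ ⊨ Q
  σ ⊨ ∃ₐ x P = Σ ℕ λ n → (σ [ x ↦ n ]) ⊨ P
  σ ⊨ ∀ₐ x P = (n : ℕ) → (σ [ x ↦ n ]) ⊨ P

  _⊨ₐ_ : Assn → Assn → Set
  P ⊨ₐ Q = (σ : State) → σ ⊨ P → σ ⊨ Q

  mutual
    supE : (Var → ℕ) → Expr → ℕ
    supE g (var x) = g x
    supE g (const n) = 0
    supE g (app f es) = supE* g es

    supE* : ∀ {k} → (Var → ℕ) → Vec Expr k → ℕ
    supE* g [] = 0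
    supE* g (e ∷ es) = supE g e ⊔ supE* g es

  supC : (Var → ℕ) → Cond → ℕ
  supC g (pred q es) = supE* g es
  supC g (e₁ == e₂) = supE g e₁ ⊔ supE g e₂
  supC g (e₁ ≤ᶜ e₂) = supE g e₁ ⊔ supE g e₂
  supC g (notᶜ B) = supC g B
  supC g (B₁ andᶜ B₂) = supC g B₁ ⊔ supC g B₂
  supC g (B₁ orᶜ B₂) = supC g B₁ ⊔ supC g B₂

  supA : (Var → ℕ) → Assn → ℕ
  supA g (cond B) = supC g B
  supA g (¬ₐ P) = supA g P
  supA g (P ∨ₐ Q) = supA g P ⊔ supA g Q
  supA g (P ∧ₐ Q) = supA g P ⊔ supA g Q
  supA g (P ⇒ₐ Q) = supA g P ⊔ supA g Q
  supA g (∃ₐ x P) = g x ⊔ supA g P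
  supA g (∀ₐ x P) = g x ⊔ supA g P

  maxVar : Expr → ℕ
  maxVar = supE (λ x → x)

  Subst : Set
  Subst = Var → Expr

  mutual
    substE : Subst → Expr → Expr
    substE s (var x) = s x
    substE s (const n) = const n
    substE s (app f es) = app f (substE* s es)

    substE* : ∀ {k} → Subst → Vec Expr k → Vec Expr k
    substE* s [] = []
    substE* s (e ∷ es) = substE s e ∷ substE* s es

  substC : Subst → Cond → Cond
  substC s (pred q es) = pred q (substE* s es)
  substC s (e₁ == e₂) = substE s e₁ == substE s e₂
  substC s (e₁ ≤ᶜ e₂) = substE s e₁ ≤ᶜ substE s e₂
  substC s (notᶜ B) = notᶜ (substC s B)
  substC s (B₁ andᶜ B₂) = substC s B₁ andᶜ substC s B₂
  substC s (B₁ orᶜ B₂) = substC s B₁ orᶜ substC s B₂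

  -- a variable not occurring in s v for any variable v of P
  fresh : Subst → Assn → Var
  fresh s P = suc (supA (λ v → maxVar (s v)) P)

  substA : Subst → Assn → Assn
  substA s (cond B) = cond (substC s B)
  substA s (¬ₐ P) = ¬ₐ substA s P
  substA s (P ∨ₐ Q) = substA s P ∨ₐ substA s Q
  substA s (P ∧ₐ Q) = substA s P ∧ₐ substA s Q
  substA s (P ⇒ₐ Q) = substA s P ⇒ₐ substA s Q
  substA s (∃ₐ y P) = ∃ₐ (fresh s P) (substA (s [ y ↦ var (fresh s P) ]) P)
  substA s (∀ₐ y P) = ∀ₐ (fresh s P) (substA (s [ y ↦ var (fresh s P) ]) P)

  _[_≔_] : Assn → Var → Expr → Assn
  Q [ x ≔ E ] = substA (var [ x ↦ E ]) Q

  Config : Set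
  Config = Prog × State

  data _⟶_ : Config → Config → Set where
    step-assign : ∀ {x E σ} →
      (ne (x := E) , σ) ⟶ (ε , σ [ x ↦ ⟦ E ⟧ σ ])
    step-while-true : ∀ {B C σ} → σ ⊨ᶜ B →
      (ne (while B loop C) , σ) ⟶ (C ⨾ ne (while B loop C) , σ)
    step-while-false : ∀ {B C σ} → ¬ (σ ⊨ᶜ B) →
      (ne (while B loop C) , σ) ⟶ (ε , σ)
    step-seq : ∀ {a b C₀' σ σ'} →
      (ne a , σ) ⟶ (C₀' , σ') →
      (ne (a ︔ b) , σ) ⟶ (C₀' ⨾ ne b , σ')
    step-or₀ : ∀ {C₀ C₁ σ} → (ne (C₀ or C₁) , σ) ⟶ (C₀ , σ)
    step-or₁ : ∀ {C₀ C₁ σ} → (ne (C₀ or C₁) , σ) ⟶ (C₁ , σ)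

  _⟶*_ : Config → Config → Set
  _⟶*_ = Star _⟶_

  Valid : Assn → Prog → Assn → Set
  Valid P C Q = (σ σ' : State) → σ' ⊨ Q → (C , σ) ⟶* (ε , σ') → σ ⊨ P

  WPRExpressive : Set
  WPRExpressive = (Q : Assn) (C : Prog) → Σ Assn λ P → (σ : State) →
    ((σ ⊨ P) → Σ State λ σ' → ((C , σ) ⟶* (ε , σ')) × (σ' ⊨ Q))
    × ((Σ State λ σ' → ((C , σ) ⟶* (ε , σ')) × (σ' ⊨ Q)) → σ ⊨ P)

  data ⊢PRHL : Assn → Prog → Assn → Set where
    axiom  : ∀ {Q} → ⊢PRHL Q ε Q
    assign : ∀ {Q x E} → ⊢PRHL (Q [ x ≔ E ]) (ne (x := E)) Q
    seq    : ∀ {P R Q C₀ C₁} → ⊢PRHL P C₀ R → ⊢PRHL R C₁ Q →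
             ⊢PRHL P (C₀ ⨾ C₁) Q
    cons   : ∀ {P Q P' Q' C} → ⊢PRHL P C Q → P ⊨ₐ P' → Q' ⊨ₐ Q →
             ⊢PRHL P' C Q'
    or     : ∀ {P Q C₀ C₁} → ⊢PRHL P C₀ Q → ⊢PRHL P C₁ Q →
             ⊢PRHL P (ne (C₀ or C₁)) Q
    while  : ∀ {B P C} → ⊢PRHL (cond B ⇒ₐ P) C P →
             ⊢PRHL P (ne (while B loop C)) ((¬ₐ (cond B)) ⇒ₐ P)

-- For every program C and postcondition Q, expressiveness yields an assertion wpr Q C
-- describing exactly the states from which some run of C terminates in Q. By induction on C,
-- {wpr Q C} C {Q} is derivable: each rule of PRHL only needs a semantic entailment that follows
-- from wpr being closed under backward reduction, and for a loop wpr Q (while B do C) is itself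
-- the invariant. A valid triple {P} C {Q} means precisely wpr Q C ⊨ P, so the consequence rule
-- finishes the proof.
{-# OPTIONS --safe #-}
module Submission where

open import Data.Bool using (true; false; if_then_else_)
open import Data.Empty using (⊥)
open import Data.Nat using (ℕ; _≟_; _≤_; _⊔_; s≤s)
open import Data.Nat.Properties using (≤-refl; ≤-trans; <⇒≢; m≤n⇒m≤n⊔o; m≤n⇒m≤o⊔n)
open import Data.Product using (Σ; _×_; _,_; proj₁; proj₂; map₁)
open import Data.Product.Function.Dependent.Propositional using (Σ-⇔)
open import Data.Product.Function.NonDependent.Propositional using (_×-⇔_)
open import Data.Sum using (_⊎_; inj₁; inj₂; [_,_])
open import Data.Sum.Function.Propositional using (_⊎-⇔_)
open import Data.Vec using (Vec; []; _∷_)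
open import Function using (_∘_; id)
open import Function.Bundles using (_⇔_; mk⇔; Equivalence)
open import Function.Construct.Composition using (_⇔-∘_)
open import Function.Construct.Identity using (↠-id)
open import Function.Related.Propositional using (K-reflexive)
open import Function.Related.TypeIsomorphisms using (→-cong-⇔; ¬-cong-⇔)
open import Relation.Binary.PropositionalEquality using (_≡_; _≢_; refl; sym; cong; cong₂; module ≡-Reasoning)
open import Relation.Nullary using (¬_; does)
open import Relation.Nullary.Decidable using (dec-true; dec-false)
import Relation.Binary.Construct.Closure.ReflexiveTransitive as Star
open Star using (_◅◅_; gmap; return)

open import Defs hiding (⟦_⟧; ⟦_⟧*; _⊨ᶜ_; _⊨_; _⊨ₐ_; _[_≔_]; _⨾_; _⟶_; _⟶*_)
import Defs as D

⊔-either : {A B : Set} {x m n : ℕ} → (A → x ≤ m) → (B → x ≤ n) → A ⊎ B → x ≤ m ⊔ n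
⊔-either {m = m} {n} x≤m x≤n = [ m≤n⇒m≤n⊔o n ∘ x≤m , m≤n⇒m≤o⊔n m ∘ x≤n ]

Π-⇔ : {A B : ℕ → Set} → (∀ {n} → A n ⇔ B n) → (∀ n → A n) ⇔ (∀ n → B n)
Π-⇔ A⇔B = mk⇔ (λ a n → Equivalence.to A⇔B (a n)) (λ b n → Equivalence.from A⇔B (b n))

AgreeOn : {A : Set} → (Var → Set) → (Var → A) → (Var → A) → Set
AgreeOn O f g = ∀ y → O y → f y ≡ g y

module _ {A : Set} {O₁ O₂ : Var → Set} {f g : Var → A} where

  AgreeOn-⊎ˡ : AgreeOn (λ y → O₁ y ⊎ O₂ y) f g → AgreeOn O₁ f g
  AgreeOn-⊎ˡ f≈g y = f≈g y ∘ inj₁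

  AgreeOn-⊎ʳ : AgreeOn (λ y → O₁ y ⊎ O₂ y) f g → AgreeOn O₂ f g
  AgreeOn-⊎ʳ f≈g y = f≈g y ∘ inj₂

module _ {A : Set} (f : Var → A) (x : Var) (a : A) where

  ↦-≡ : (f [ x ↦ a ]) x ≡ a
  ↦-≡ = cong (λ b → if b then a else f x) (dec-true (x ≟ x) refl)

  ↦-≢ : ∀ {y} → x ≢ y → (f [ x ↦ a ]) y ≡ f y
  ↦-≢ {y} x≢y = cong (λ b → if b then a else f y) (dec-false (x ≟ y) x≢y)

  ↦-map : {B : Set} (h : A → B) (y : Var) → h ((f [ x ↦ a ]) y) ≡ ((h ∘ f) [ x ↦ h a ]) y
  ↦-map h y with does (x ≟ y)
  ... | true = refl
  ... | false = refl

↦-agree : {A : Set} {O : Var → Set} {f g : Var → A} (x : Var) (a : A) →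
          AgreeOn O f g → AgreeOn O (f [ x ↦ a ]) (g [ x ↦ a ])
↦-agree x a f≈g y o with does (x ≟ y)
... | true = refl
... | false = f≈g y o

module _ (S : Signature) where
  open Signature S

  infix 4 _⊨ᶜ_ _⊨_ _⊨ₐ_ _⟶_ _⟶*_ _∈ᵉ_ _∈ᵉ*_ _∈ᶜ_ _∈ᵃ_

  ⟦_⟧ : Expr S → State → ℕ
  ⟦_⟧ = D.⟦_⟧ S

  ⟦_⟧* : ∀ {k} → Vec (Expr S) k → State → Vec ℕ k
  ⟦_⟧* = D.⟦_⟧* S

  _⊨ᶜ_ : State → Cond S → Set
  _⊨ᶜ_ = D._⊨ᶜ_ S

  _⊨_ : State → Assn S → Set
  _⊨_ = D._⊨_ S

  _⊨ₐ_ : Assn S → Assn S → Set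
  _⊨ₐ_ = D._⊨ₐ_ S

  _[_≔_] : Assn S → Var → Expr S → Assn S
  _[_≔_] = D._[_≔_] S

  _⨾_ : Prog S → Prog S → Prog S
  _⨾_ = D._⨾_ S

  _⟶_ : Config S → Config S → Set
  _⟶_ = D._⟶_ S

  _⟶*_ : Config S → Config S → Set
  _⟶*_ = D._⟶*_ S

  -- Variables occurring in atoms: a superset of the free variables, which is all that agreement needs.
  mutual
    _∈ᵉ_ : Var → Expr S → Set
    w ∈ᵉ var x = w ≡ x
    w ∈ᵉ const _ = ⊥
    w ∈ᵉ app f es = w ∈ᵉ* es

    _∈ᵉ*_ : ∀ {k} → Var → Vec (Expr S) k → Set
    w ∈ᵉ* [] = ⊥
    w ∈ᵉ* (e ∷ es) = w ∈ᵉ e ⊎ w ∈ᵉ* es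

  _∈ᶜ_ : Var → Cond S → Set
  w ∈ᶜ pred q es = w ∈ᵉ* es
  w ∈ᶜ (a == b) = w ∈ᵉ a ⊎ w ∈ᵉ b
  w ∈ᶜ (a ≤ᶜ b) = w ∈ᵉ a ⊎ w ∈ᵉ b
  w ∈ᶜ notᶜ B = w ∈ᶜ B
  w ∈ᶜ (B andᶜ B′) = w ∈ᶜ B ⊎ w ∈ᶜ B′
  w ∈ᶜ (B orᶜ B′) = w ∈ᶜ B ⊎ w ∈ᶜ B′

  _∈ᵃ_ : Var → Assn S → Set
  w ∈ᵃ cond B = w ∈ᶜ B
  w ∈ᵃ (¬ₐ P) = w ∈ᵃ P
  w ∈ᵃ (P ∨ₐ Q) = w ∈ᵃ P ⊎ w ∈ᵃ Q
  w ∈ᵃ (P ∧ₐ Q) = w ∈ᵃ P ⊎ w ∈ᵃ Q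
  w ∈ᵃ (P ⇒ₐ Q) = w ∈ᵃ P ⊎ w ∈ᵃ Q
  w ∈ᵃ ∃ₐ _ P = w ∈ᵃ P
  w ∈ᵃ ∀ₐ _ P = w ∈ᵃ P

  mutual
    supE-∈ : ∀ g e {w} → w ∈ᵉ e → g w ≤ supE S g e
    supE-∈ g (var x) refl = ≤-refl
    supE-∈ g (app f es) w∈es = supE*-∈ g es w∈es

    supE*-∈ : ∀ g {k} (es : Vec (Expr S) k) {w} → w ∈ᵉ* es → g w ≤ supE* S g es
    supE*-∈ g (e ∷ es) = ⊔-either (supE-∈ g e) (supE*-∈ g es)

  supC-∈ : ∀ g B {w} → w ∈ᶜ B → g w ≤ supC S g B
  supC-∈ g (pred q es) = supE*-∈ g es
  supC-∈ g (a == b) = ⊔-either (supE-∈ g a) (supE-∈ g b)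
  supC-∈ g (a ≤ᶜ b) = ⊔-either (supE-∈ g a) (supE-∈ g b)
  supC-∈ g (notᶜ B) = supC-∈ g B
  supC-∈ g (B andᶜ B′) = ⊔-either (supC-∈ g B) (supC-∈ g B′)
  supC-∈ g (B orᶜ B′) = ⊔-either (supC-∈ g B) (supC-∈ g B′)

  supA-∈ : ∀ g P {w} → w ∈ᵃ P → g w ≤ supA S g P
  supA-∈ g (cond B) = supC-∈ g B
  supA-∈ g (¬ₐ P) = supA-∈ g P
  supA-∈ g (P ∨ₐ Q) = ⊔-either (supA-∈ g P) (supA-∈ g Q)
  supA-∈ g (P ∧ₐ Q) = ⊔-either (supA-∈ g P) (supA-∈ g Q)
  supA-∈ g (P ⇒ₐ Q) = ⊔-either (supA-∈ g P) (supA-∈ g Q)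
  supA-∈ g (∃ₐ y P) = m≤n⇒m≤o⊔n (g y) ∘ supA-∈ g P
  supA-∈ g (∀ₐ y P) = m≤n⇒m≤o⊔n (g y) ∘ supA-∈ g P

  fresh-≢ : ∀ s P {w u} → w ∈ᵃ P → u ∈ᵉ s w → fresh S s P ≢ u
  fresh-≢ s P {w} w∈P u∈sw =
    <⇒≢ (s≤s (≤-trans (supE-∈ id (s w) u∈sw) (supA-∈ (maxVar S ∘ s) P w∈P))) ∘ sym

  mutual
    ⟦⟧-agree : ∀ e {σ τ} → AgreeOn (_∈ᵉ e) σ τ → ⟦ e ⟧ σ ≡ ⟦ e ⟧ τ
    ⟦⟧-agree (var x) σ≈τ = σ≈τ x refl
    ⟦⟧-agree (const n) σ≈τ = refl
    ⟦⟧-agree (app f es) σ≈τ = cong (funInterp f) (⟦⟧*-agree es σ≈τ)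

    ⟦⟧*-agree : ∀ {k} (es : Vec (Expr S) k) {σ τ} → AgreeOn (_∈ᵉ* es) σ τ → ⟦ es ⟧* σ ≡ ⟦ es ⟧* τ
    ⟦⟧*-agree [] σ≈τ = refl
    ⟦⟧*-agree (e ∷ es) σ≈τ =
      cong₂ _∷_ (⟦⟧-agree e (AgreeOn-⊎ˡ σ≈τ)) (⟦⟧*-agree es (AgreeOn-⊎ʳ σ≈τ))

  ⊨ᶜ-agree : ∀ B {σ τ} → AgreeOn (_∈ᶜ B) σ τ → (σ ⊨ᶜ B) ≡ (τ ⊨ᶜ B)
  ⊨ᶜ-agree (pred q es) σ≈τ = cong (predInterp q) (⟦⟧*-agree es σ≈τ)
  ⊨ᶜ-agree (a == b) σ≈τ = cong₂ _≡_ (⟦⟧-agree a (AgreeOn-⊎ˡ σ≈τ)) (⟦⟧-agree b (AgreeOn-⊎ʳ σ≈τ))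
  ⊨ᶜ-agree (a ≤ᶜ b) σ≈τ = cong₂ _≤_ (⟦⟧-agree a (AgreeOn-⊎ˡ σ≈τ)) (⟦⟧-agree b (AgreeOn-⊎ʳ σ≈τ))
  ⊨ᶜ-agree (notᶜ B) σ≈τ = cong ¬_ (⊨ᶜ-agree B σ≈τ)
  ⊨ᶜ-agree (B andᶜ B′) σ≈τ = cong₂ _×_ (⊨ᶜ-agree B (AgreeOn-⊎ˡ σ≈τ)) (⊨ᶜ-agree B′ (AgreeOn-⊎ʳ σ≈τ))
  ⊨ᶜ-agree (B orᶜ B′) σ≈τ = cong₂ _⊎_ (⊨ᶜ-agree B (AgreeOn-⊎ˡ σ≈τ)) (⊨ᶜ-agree B′ (AgreeOn-⊎ʳ σ≈τ))

  ⊨-agree : ∀ P {σ τ} → AgreeOn (_∈ᵃ P) σ τ → (σ ⊨ P) ⇔ (τ ⊨ P)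
  ⊨-agree (cond B) σ≈τ = K-reflexive (⊨ᶜ-agree B σ≈τ)
  ⊨-agree (¬ₐ P) σ≈τ = ¬-cong-⇔ (⊨-agree P σ≈τ)
  ⊨-agree (P ∨ₐ Q) σ≈τ = ⊨-agree P (AgreeOn-⊎ˡ σ≈τ) ⊎-⇔ ⊨-agree Q (AgreeOn-⊎ʳ σ≈τ)
  ⊨-agree (P ∧ₐ Q) σ≈τ = ⊨-agree P (AgreeOn-⊎ˡ σ≈τ) ×-⇔ ⊨-agree Q (AgreeOn-⊎ʳ σ≈τ)
  ⊨-agree (P ⇒ₐ Q) σ≈τ = →-cong-⇔ (⊨-agree P (AgreeOn-⊎ˡ σ≈τ)) (⊨-agree Q (AgreeOn-⊎ʳ σ≈τ))
  ⊨-agree (∃ₐ y P) σ≈τ = Σ-⇔ (↠-id ℕ) (⊨-agree P (↦-agree y _ σ≈τ))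
  ⊨-agree (∀ₐ y P) σ≈τ = Π-⇔ (⊨-agree P (↦-agree y _ σ≈τ))

  ⟦_⟧ˢ : Subst S → State → State
  ⟦ s ⟧ˢ σ v = ⟦ s v ⟧ σ

  mutual
    ⟦⟧-substE : ∀ s e σ → ⟦ substE S s e ⟧ σ ≡ ⟦ e ⟧ (⟦ s ⟧ˢ σ)
    ⟦⟧-substE s (var x) σ = refl
    ⟦⟧-substE s (const n) σ = refl
    ⟦⟧-substE s (app f es) σ = cong (funInterp f) (⟦⟧*-substE* s es σ)

    ⟦⟧*-substE* : ∀ {k} s (es : Vec (Expr S) k) σ → ⟦ substE* S s es ⟧* σ ≡ ⟦ es ⟧* (⟦ s ⟧ˢ σ)
    ⟦⟧*-substE* s [] σ = refl
    ⟦⟧*-substE* s (e ∷ es) σ = cong₂ _∷_ (⟦⟧-substE s e σ) (⟦⟧*-substE* s es σ)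

  ⊨ᶜ-substC : ∀ s B σ → (σ ⊨ᶜ substC S s B) ≡ (⟦ s ⟧ˢ σ ⊨ᶜ B)
  ⊨ᶜ-substC s (pred q es) σ = cong (predInterp q) (⟦⟧*-substE* s es σ)
  ⊨ᶜ-substC s (a == b) σ = cong₂ _≡_ (⟦⟧-substE s a σ) (⟦⟧-substE s b σ)
  ⊨ᶜ-substC s (a ≤ᶜ b) σ = cong₂ _≤_ (⟦⟧-substE s a σ) (⟦⟧-substE s b σ)
  ⊨ᶜ-substC s (notᶜ B) σ = cong ¬_ (⊨ᶜ-substC s B σ)
  ⊨ᶜ-substC s (B andᶜ B′) σ = cong₂ _×_ (⊨ᶜ-substC s B σ) (⊨ᶜ-substC s B′ σ)
  ⊨ᶜ-substC s (B orᶜ B′) σ = cong₂ _⊎_ (⊨ᶜ-substC s B σ) (⊨ᶜ-substC s B′ σ)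

  ⟦⟧ˢ-bind : ∀ s y P σ n → let z = fresh S s P in
             AgreeOn (_∈ᵃ P) (⟦ s [ y ↦ var z ] ⟧ˢ (σ [ z ↦ n ])) (⟦ s ⟧ˢ σ [ y ↦ n ])
  ⟦⟧ˢ-bind s y P σ n w w∈P = begin
    ⟦ (s [ y ↦ var z ]) w ⟧ σ′  ≡⟨ ↦-map s y (var z) (λ e → ⟦ e ⟧ σ′) w ⟩
    (⟦ s ⟧ˢ σ′ [ y ↦ σ′ z ]) w  ≡⟨ cong (λ m → (⟦ s ⟧ˢ σ′ [ y ↦ m ]) w) (↦-≡ σ z n) ⟩
    (⟦ s ⟧ˢ σ′ [ y ↦ n ]) w     ≡⟨ ↦-agree y n z-unused w w∈P ⟩
    (⟦ s ⟧ˢ σ [ y ↦ n ]) w      ∎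
    where
      open ≡-Reasoning
      z : Var
      z = fresh S s P
      σ′ : State
      σ′ = σ [ z ↦ n ]
      z-unused : AgreeOn (_∈ᵃ P) (⟦ s ⟧ˢ σ′) (⟦ s ⟧ˢ σ)
      z-unused v v∈P = ⟦⟧-agree (s v) λ u u∈sv → ↦-≢ σ z n (fresh-≢ s P v∈P u∈sv)

  ⊨-substA : ∀ P s σ → (σ ⊨ substA S s P) ⇔ (⟦ s ⟧ˢ σ ⊨ P)
  ⊨-substA (cond B) s σ = K-reflexive (⊨ᶜ-substC s B σ)
  ⊨-substA (¬ₐ P) s σ = ¬-cong-⇔ (⊨-substA P s σ)
  ⊨-substA (P ∨ₐ Q) s σ = ⊨-substA P s σ ⊎-⇔ ⊨-substA Q s σ
  ⊨-substA (P ∧ₐ Q) s σ = ⊨-substA P s σ ×-⇔ ⊨-substA Q s σ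
  ⊨-substA (P ⇒ₐ Q) s σ = →-cong-⇔ (⊨-substA P s σ) (⊨-substA Q s σ)
  ⊨-substA (∃ₐ y P) s σ = Σ-⇔ (↠-id ℕ) (⊨-agree P (⟦⟧ˢ-bind s y P σ _) ⇔-∘ ⊨-substA P _ _)
  ⊨-substA (∀ₐ y P) s σ = Π-⇔ (⊨-agree P (⟦⟧ˢ-bind s y P σ _) ⇔-∘ ⊨-substA P _ _)

  ⊨-[≔] : ∀ Q x E {σ} → σ ⊨ Q [ x ≔ E ] → (σ [ x ↦ ⟦ E ⟧ σ ]) ⊨ Q
  ⊨-[≔] Q x E {σ} =
    Equivalence.to (⊨-agree Q λ w _ → ↦-map var x E (λ e → ⟦ e ⟧ σ) w)
    ∘ Equivalence.to (⊨-substA Q (var [ x ↦ E ]) σ)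

  ⟶-⨾ : ∀ b {C σ C′ σ′} → (C , σ) ⟶ (C′ , σ′) → (C ⨾ ne b , σ) ⟶ (C′ ⨾ ne b , σ′)
  ⟶-⨾ b {ne a} step = step-seq step

  ⟶*-⨾ : ∀ b {C σ C′ σ′} → (C , σ) ⟶* (C′ , σ′) → (C ⨾ ne b , σ) ⟶* (C′ ⨾ ne b , σ′)
  ⟶*-⨾ b = gmap (map₁ (_⨾ ne b)) (⟶-⨾ b)

  cons-pre : ∀ {P P′ C Q} → ⊢PRHL S P C Q → P ⊨ₐ P′ → ⊢PRHL S P′ C Q
  cons-pre d P⊨P′ = cons d P⊨P′ (λ _ → id)

  module _ (expressive : WPRExpressive S) where

    wpr : Assn S → Prog S → Assn S
    wpr Q C = proj₁ (expressive Q C)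

    wpr-sound : ∀ {Q C σ} → σ ⊨ wpr Q C → Σ State λ σ′ → (C , σ) ⟶* (ε , σ′) × σ′ ⊨ Q
    wpr-sound {Q} {C} {σ} = proj₁ (proj₂ (expressive Q C) σ)

    wpr-complete : ∀ {Q C σ σ′} → (C , σ) ⟶* (ε , σ′) → σ′ ⊨ Q → σ ⊨ wpr Q C
    wpr-complete {Q} {C} {σ} {σ′} run q = proj₂ (proj₂ (expressive Q C) σ) (σ′ , run , q)

    wpr-backward : ∀ {Q C σ C′ σ′} → (C , σ) ⟶* (C′ , σ′) → σ′ ⊨ wpr Q C′ → σ ⊨ wpr Q C
    wpr-backward run h = let (_ , run′ , q) = wpr-sound h in wpr-complete (run ◅◅ run′) q

    wpr-⨾ : ∀ {Q C b σ} → σ ⊨ wpr (wpr Q (ne b)) C → σ ⊨ wpr Q (C ⨾ ne b)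
    wpr-⨾ {b = b} h = let (_ , run , q) = wpr-sound h in wpr-backward (⟶*-⨾ b run) q

    ⊢wpr : ∀ C Q → ⊢PRHL S (wpr Q C) C Q
    ⊢wpr ε Q = cons-pre axiom λ _ → wpr-complete Star.ε
    ⊢wpr (ne (x := E)) Q = cons-pre assign λ _ → wpr-complete (return step-assign) ∘ ⊨-[≔] Q x E
    ⊢wpr (ne (a ︔ b)) Q = cons-pre (seq (⊢wpr (ne a) (wpr Q (ne b))) (⊢wpr (ne b) Q)) λ _ → wpr-⨾
    ⊢wpr (ne (C₀ or C₁)) Q =
      or (cons-pre (⊢wpr C₀ Q) λ _ → wpr-backward (return step-or₀))
         (cons-pre (⊢wpr C₁ Q) λ _ → wpr-backward (return step-or₁))
    ⊢wpr (ne (while B loop C)) Q = cons (while (cons-pre (⊢wpr C I) invariant)) (λ _ → id) exit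
      where
        I : Assn S
        I = wpr Q (ne (while B loop C))
        invariant : wpr I C ⊨ₐ (cond B ⇒ₐ I)
        invariant _ h b = wpr-backward (return (step-while-true b)) (wpr-⨾ h)
        exit : Q ⊨ₐ ((¬ₐ cond B) ⇒ₐ I)
        exit _ q ¬b = wpr-complete (return (step-while-false ¬b)) q

    valid⇒wpr⊨ : ∀ {P C Q} → Valid S P C Q → wpr Q C ⊨ₐ P
    valid⇒wpr⊨ valid σ h = let (σ′ , run , q) = wpr-sound h in valid σ σ′ q run

theorem3p6 : (S : Signature) → WPRExpressive S →
    (P : Assn S) (C : Prog S) (Q : Assn S) →
    Valid S P C Q → ⊢PRHL S P C Q
theorem3p6 S expressive P C Q valid = cons-pre S (⊢wpr S expressive C Q) (valid⇒wpr⊨ S expressive {P} valid)
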